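{- Let $\mathbb{N}=\{1,2,3,\ldots\}$, let $f:\mathbb{N}\times\mathbb{N}\to\mathbb{N}$ be the function $f(n,m)=2^n m$, and let $\mathcal{U}$ be any ultrafilter on $\mathbb{N}$ that satisfies the following property: ($\star$) if $X\in\mathcal{U}$, then for every $\ell\in\mathbb{N}$ there exist $b,c\in\mathbb{N}$ with $\{b,c,b+\ell c\}\subseteq X$. Then for every $A\in f_*(\mathcal{U}\otimes\mathcal{U})$ there exist $x,y\in\mathbb{N}$ such that $\{x, y, 2^x y\}\subseteq A$.
   Context: For an ultrafilter $\mathcal{U}$ on a set $I$ and a function $g:I\to J$, the image ultrafilter $g_*(\mathcal{U})$ on $J$ is defined by $B\in g_*(\mathcal{U})\iff g^{ -1}(B)\in\mathcal{U}$. For ultrafilters $\mathcal{U},\mathcal{V}$ on sets $I,J$, the tensor product $\mathcal{U}\otimes\mathcal{V}$ is the ultrafilter on $I\times J$ defined by $X\in\mathcal{U}\otimes\mathcal{V}\iff \{i\in I\mid \{j\in J\mid (i,j)\in X\}\in\mathcal{V}\}\in\mathcal{U}$. -}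

module Defs where

open import Level using (0ℓ)
open import Data.Nat using (ℕ; zero; suc; _+_; _*_; _^_; NonZero)
open import Data.Nat.Properties using (m*n≢0; m^n≢0)
open import Data.Product using (Σ; _×_; _,_; ∃-syntax)
open import Data.Sum using (_⊎_)
open import Relation.Nullary using (¬_)
open import Relation.Unary using (Pred; _⊆_; _∩_; ∁; ∅; U)

ℕ⁺ : Set
ℕ⁺ = Σ ℕ NonZero

val : ℕ⁺ → ℕ
val (n , _) = n

Subset : Set → Set₁
Subset I = Pred I 0ℓ

record Ultrafilter (I : Set) : Set₁ where
  field
    _∈U : Subset I → Set
    upward : ∀ {X Y : Subset I} → X ⊆ Y → X ∈U → Y ∈U
    inter  : ∀ {X Y : Subset I} → X ∈U → Y ∈U → (X ∩ Y) ∈U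
    whole  : U ∈U
    proper : ¬ (∅ ∈U)
    ultra  : ∀ (X : Subset I) → X ∈U ⊎ (∁ X) ∈U
open Ultrafilter public

_∈_⊗_ : ∀ {I J : Set} → Subset (I × J) → Ultrafilter I → Ultrafilter J → Set
X ∈ 𝒰 ⊗ 𝒱 = (𝒰 ∈U) (λ i → (𝒱 ∈U) (λ j → X (i , j)))

image-∈ : ∀ {I J : Set} → (g : I → J) → (Subset I → Set) → Subset J → Set
image-∈ g W B = W (λ i → B (g i))

f : ℕ⁺ × ℕ⁺ → ℕ⁺
f ((n , _) , (m , m≢0)) = 2 ^ n * m , m*n≢0 (2 ^ n) m {{m^n≢0 2 n}} {{m≢0}}

lin : ℕ⁺ → ℕ⁺ → ℕ⁺ → ℕ⁺
lin (suc b , _) (l , _) (c , _) = suc b + l * c , _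

Star : Ultrafilter ℕ⁺ → Set₁
Star 𝒰 = ∀ (X : Subset ℕ⁺) → (𝒰 ∈U) X →
         ∀ (ℓ : ℕ⁺) → ∃[ b ] ∃[ c ] (X b × X c × X (lin b ℓ c))

{-# OPTIONS --safe #-}
-- Let S = {n | {m | 2ⁿm ∈ A} ∈ 𝒰} ∈ 𝒰 and fix n ∈ S. Applying (⋆) with ℓ = 2ⁿ to
-- S ∩ {m | 2ⁿm ∈ A} gives b, c with b, b + 2ⁿc ∈ S and x := 2ⁿc ∈ A. Then some m has
-- y := 2ᵇm ∈ A and 2^(b + 2ⁿc) m ∈ A; the latter number is 2^x y.
module Submission where

open import Defs
open import Data.Bool.Properties using (T-irrelevant)
open import Data.Nat using (suc; _+_; _*_; _^_; NonZero)
open import Data.Nat.Properties using (m^n≢0; ^-distribˡ-+-*; *-assoc; +-comm)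
open import Data.Product using (_×_; _,_; ∃; ∃-syntax)
open import Relation.Binary.PropositionalEquality using (_≡_; refl; cong; subst; module ≡-Reasoning)
open import Relation.Unary using (_∩_)

NonZero-irrelevant : ∀ {n} (p q : NonZero n) → p ≡ q
NonZero-irrelevant record { nonZero = p } record { nonZero = q } =
  cong (λ r → record { nonZero = r }) (T-irrelevant p q)

val-injective : ∀ {x y : ℕ⁺} → val x ≡ val y → x ≡ y
val-injective {n , p} {.n , q} refl = cong (n ,_) (NonZero-irrelevant p q)

pow2 : ℕ⁺ → ℕ⁺
pow2 (n , _) = 2 ^ n , m^n≢0 2 n

f-lin-pow2 : ∀ b n c m → f (lin b (pow2 n) c , m) ≡ f (f (n , c) , f (b , m))
f-lin-pow2 (suc b , _) n c (m , _) = val-injective (begin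
  2 ^ (suc b + x) * m       ≡⟨ cong (λ k → 2 ^ k * m) (+-comm (suc b) x) ⟩
  2 ^ (x + suc b) * m       ≡⟨ cong (_* m) (^-distribˡ-+-* 2 x (suc b)) ⟩
  2 ^ x * 2 ^ suc b * m     ≡⟨ *-assoc (2 ^ x) (2 ^ suc b) m ⟩
  2 ^ x * (2 ^ suc b * m)   ∎)
  where
  open ≡-Reasoning
  x = val (f (n , c))

Star⇒nonempty : ∀ 𝒰 → Star 𝒰 → ∀ X → (𝒰 ∈U) X → ∃ X
Star⇒nonempty 𝒰 star X X∈𝒰 with star X X∈𝒰 (1 , _)
... | b , _ , Xb , _ = b , Xb

fibre : Subset ℕ⁺ → ℕ⁺ → Subset ℕ⁺
fibre A n m = A (f (n , m))

large-fibres : Ultrafilter ℕ⁺ → Subset ℕ⁺ → Subset ℕ⁺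
large-fibres 𝒰 A n = (𝒰 ∈U) (fibre A n)

theorem1 : (𝒰 : Ultrafilter ℕ⁺) → Star 𝒰 →
    ∀ (A : Subset ℕ⁺) → image-∈ f (λ X → X ∈ 𝒰 ⊗ 𝒰) A →
    ∃[ x ] ∃[ y ] (A x × A y × A (f (x , y)))
theorem1 𝒰 star A S∈𝒰 with Star⇒nonempty 𝒰 star (large-fibres 𝒰 A) S∈𝒰
... | n , Sn with star (large-fibres 𝒰 A ∩ fibre A n) (inter 𝒰 S∈𝒰 Sn) (pow2 n)
...   | b , c , (Sb , _) , (_ , Ac) , (Sz , _) with Star⇒nonempty 𝒰 star _ (inter 𝒰 Sb Sz)
...     | m , Ab , Az = f (n , c) , f (b , m) , Ac , Ab , subst A (f-lin-pow2 b n c m) Az
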